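{- Let $m, n \ge 2$ be integers and let $D = C_m \Box C_n$ be the Cartesian product of directed cycles, with vertex set $\mathbb{Z}_m \times \mathbb{Z}_n$ and arcs $(i,j) \to (i+1,j)$ and $(i,j) \to (i,j+1)$. Then \[ \gamma_I(C_m \Box C_n) = \begin{cases} \frac{mn}{2}, & m \equiv n \equiv 0 \pmod{2}; \\ \frac{m(n+1)}{2}, & m \equiv 0,\ n \equiv 1 \pmod{2}; \\ \frac{m(n + 1)}{2}, & m \equiv n \equiv 1 \pmod{2},\ m \ge n. \end{cases} \]
   Context: For a digraph $D$, an Italian dominating function is a function $f: V(D) \to \{0,1,2\}$ such that every vertex $v$ with $f(v)=0$ has an in-neighbour $w$ with $f(w)=2$ or two in-neighbours $x_1, x_2$ with $f(x_1)=f(x_2)=1$. Its weight is $\sum_{v \in V(D)} f(v)$, and the Italian domination number $\gamma_I(D)$ is the minimum weight of an Italian dominating function. -}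

module Defs where

open import Data.Nat using (ℕ; zero; suc; _+_; _*_; _≤_; _≥_; _%_; NonZero)
open import Data.Fin using (Fin; toℕ) renaming (zero to fzero; suc to fsuc)
import Data.Fin as F
open import Data.List using (List; map; allFin)
open import Data.Nat.ListAction using (sum)
open import Data.Product using (_×_; _,_; Σ; ∃; ∃-syntax)
open import Data.Sum using (_⊎_)
open import Relation.Binary.PropositionalEquality using (_≡_; _≢_)

record Digraph : Set₁ where
  field
    N   : ℕ
    Arc : Fin N → Fin N → Set

open Digraph public

IsItalianDF : (D : Digraph) → (Fin (N D) → Fin 3) → Set
IsItalianDF D f =
  ∀ v → toℕ (f v) ≡ 0 →
    (∃[ w ] (Arc D w v × toℕ (f w) ≡ 2))
    ⊎ (∃[ x₁ ] ∃[ x₂ ] (x₁ ≢ x₂ × Arc D x₁ v × Arc D x₂ v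
                        × toℕ (f x₁) ≡ 1 × toℕ (f x₂) ≡ 1))

weight : (D : Digraph) → (Fin (N D) → Fin 3) → ℕ
weight D f = sum (map (λ v → toℕ (f v)) (allFin (N D)))

ItalianDominationNumber : Digraph → ℕ → Set
ItalianDominationNumber D k =
  (∃[ f ] (IsItalianDF D f × weight D f ≡ k))
  × (∀ f → IsItalianDF D f → k ≤ weight D f)

-- Cartesian product of directed cycles C_m □ C_n, vertex set Z_m × Z_n,
-- vertex (i , j) encoded as Fin (m * n) via Data.Fin.combine (index i * n + j).
succMod : ∀ {k} → Fin k → Fin k → Set
succMod {suc k} a b = (toℕ a + 1) % suc k ≡ toℕ b

TorusArc : (m n : ℕ) → Fin (m * n) → Fin (m * n) → Set
TorusArc m n u v with F.remQuot {m} n u | F.remQuot {m} n v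
... | (i , j) | (i′ , j′) = (succMod i i′ × j ≡ j′) ⊎ (i ≡ i′ × succMod j j′)

CycleProduct : ℕ → ℕ → Digraph
CycleProduct m n = record { N = m * n ; Arc = TorusArc m n }

-- Split each value as f v = [f v ≥ 1] + [f v = 2].  The only in-neighbours of (i , j) are
-- (i - 1 , j) and (i , j - 1), so the Italian condition at (i , j) forces
-- [f (i , j) ≥ 1] + [f (i - 1 , j) = 2] + [f (i , j - 1) ≥ 1] ≥ 1.  Summing over row i, the
-- first and last terms both count the nonzero entries A i of row i, so 2 A i + T (i - 1) ≥ n,
-- where T counts the 2s; hence A i + T (i - 1) ≥ ⌈n/2⌉, and summing over i gives weight ≥ m ⌈n/2⌉.
--
-- Conversely, let every row carry 1s at the even positions, cyclically shifted by c i.  Every 0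
-- then has a 1 to its left, and also a 1 above it as soon as c (i - 1) and c i are neighbours on
-- the cycle C_n.  So a closed walk of length m on C_n yields an Italian dominating function of
-- weight m ⌈n/2⌉: for even m alternate between 0 and 1; for odd m ≥ n (n odd) climb once around
-- C_n and spend the even number m - n of remaining steps alternating between n - 2 and n - 1.

module Submission where

open import Defs
open import Data.Nat using (ℕ; _+_; _*_; _≤_; _≥_; _%_; _/_)
open import Data.Product using (_×_)
open import Relation.Binary.PropositionalEquality using (_≡_)

open import Data.Nat.Properties
open import Algebra.Properties.CommutativeMonoid.Sum +-0-commutativeMonoid
  using (sum; sum-syntax; sum-cong-≗; ∑-distrib-+; sum-init-last)
open import Data.Bool using (Bool; true; false; not)
open import Data.Bool.Properties using (not-involutive)
open import Data.Empty using (⊥-elim)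
open import Data.Fin using (Fin; zero; suc; toℕ; fromℕ; inject₁; combine; remQuot; _↑ˡ_; _↑ʳ_)
open import Data.Fin.Properties
  using (toℕ-fromℕ; toℕ-inject₁; toℕ≤pred[n]; toℕ<n; toℕ-injective; remQuot-combine; combine-remQuot; combine-injectiveˡ)
import Data.List.Base as List using (tabulate; map; allFin)
open import Data.List.Properties using (map-tabulate)
open import Data.Nat using (NonZero; zero; suc; _∸_; z≤n; s≤s; ⌊_/2⌋; ⌈_/2⌉)
open import Data.Nat.DivMod
  using (m≡m%n+[m/n]*n; m%n%n≡m%n; [m+n]%n≡m%n; [m+kn]%n≡m%n; m*n%n≡0; m≤n⇒m%n≡m; %-pred-≡0; %-distribˡ-+;
         m/n≡1+[m∸n]/n; *-/-assoc)
open import Data.Nat.Divisibility using (m%n≡0⇒n∣m)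
import Data.Nat.ListAction as ListAction
open import Data.Product using (∃-syntax; _,_; proj₁; proj₂; uncurry)
open import Data.Sum as Sum using (_⊎_; inj₁; inj₂)
open import Function using (_∘_; id)
open import Relation.Binary.PropositionalEquality using (refl; sym; trans; cong; cong₂; subst; subst₂; _≢_; module ≡-Reasoning)

sum-tabulate : ∀ {n} (f : Fin n → ℕ) → ListAction.sum (List.tabulate f) ≡ sum f
sum-tabulate {zero}  f = refl
sum-tabulate {suc n} f = cong (f zero +_) (sum-tabulate (f ∘ suc))

sum-const : ∀ n x → ∑[ i < n ] x ≡ n * x
sum-const zero    x = refl
sum-const (suc n) x = cong (x +_) (sum-const n x)

*≤sum : ∀ {n} {x} (f : Fin n → ℕ) → (∀ i → x ≤ f i) → n * x ≤ sum f
*≤sum {zero}  f x≤f = z≤n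
*≤sum {suc n} f x≤f = +-mono-≤ (x≤f zero) (*≤sum (f ∘ suc) (x≤f ∘ suc))

sum-↑ : ∀ m {n} (f : Fin (m + n) → ℕ) → sum f ≡ sum (f ∘ (_↑ˡ n)) + sum (f ∘ (m ↑ʳ_))
sum-↑ zero    f = refl
sum-↑ (suc m) f = trans (cong (f zero +_) (sum-↑ m (f ∘ suc))) (sym (+-assoc (f zero) _ _))

sum-combine : ∀ m {n} (f : Fin (m * n) → ℕ) → sum f ≡ ∑[ i < m ] ∑[ j < n ] f (combine i j)
sum-combine zero    f = refl
sum-combine (suc m) {n} f =
  trans (sum-↑ n f) (cong (sum (f ∘ (_↑ˡ m * n)) +_) (sum-combine m (f ∘ (n ↑ʳ_))))

weight≡∑∑ : ∀ m n f → weight (CycleProduct m n) f ≡ ∑[ i < m ] ∑[ j < n ] toℕ (f (combine i j))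
weight≡∑∑ m n f = begin
  ListAction.sum (List.map (toℕ ∘ f) (List.allFin (m * n))) ≡⟨ cong ListAction.sum (map-tabulate id (toℕ ∘ f)) ⟩
  ListAction.sum (List.tabulate (toℕ ∘ f))                  ≡⟨ sum-tabulate (toℕ ∘ f) ⟩
  sum (toℕ ∘ f)                                             ≡⟨ sum-combine m (toℕ ∘ f) ⟩
  ∑[ i < m ] ∑[ j < n ] toℕ (f (combine i j))               ∎
  where open ≡-Reasoning

[m%d+n]%d≡[m+n]%d : ∀ m n d .{{_ : NonZero d}} → (m % d + n) % d ≡ (m + n) % d
[m%d+n]%d≡[m+n]%d m n d = begin
  (m % d + n) % d          ≡⟨ %-distribˡ-+ (m % d) n d ⟩
  (m % d % d + n % d) % d  ≡⟨ cong (λ x → (x + n % d) % d) (m%n%n≡m%n m d) ⟩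
  (m % d + n % d) % d      ≡⟨ %-distribˡ-+ m n d ⟨
  (m + n) % d              ∎
  where open ≡-Reasoning

[2+n]%2≡n%2 : ∀ n → suc (suc n) % 2 ≡ n % 2
[2+n]%2≡n%2 n = trans (cong (_% 2) (+-comm 2 n)) ([m+n]%n≡m%n n 2)

%2-alternates : ∀ n → (n % 2 ≡ 0 × suc n % 2 ≡ 1) ⊎ (n % 2 ≡ 1 × suc n % 2 ≡ 0)
%2-alternates zero    = inj₁ (refl , refl)
%2-alternates (suc n) with %2-alternates n
... | inj₁ (n%2≡0 , [1+n]%2≡1) = inj₂ ([1+n]%2≡1 , trans ([2+n]%2≡n%2 n) n%2≡0)
... | inj₂ (n%2≡1 , [1+n]%2≡0) = inj₁ ([1+n]%2≡0 , trans ([2+n]%2≡n%2 n) n%2≡1)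

m%d≡n%d⇒[m∸n]%d≡0 : ∀ m n d .{{_ : NonZero d}} → m % d ≡ n % d → (m ∸ n) % d ≡ 0
m%d≡n%d⇒[m∸n]%d≡0 m n d m%d≡n%d = begin
  (m ∸ n) % d                                    ≡⟨ cong₂ (λ x y → (x ∸ y) % d) (m≡m%n+[m/n]*n m d) (m≡m%n+[m/n]*n n d) ⟩
  (m % d + m / d * d ∸ (n % d + n / d * d)) % d  ≡⟨ cong (λ r → (m % d + m / d * d ∸ (r + n / d * d)) % d) m%d≡n%d ⟨
  (m % d + m / d * d ∸ (m % d + n / d * d)) % d  ≡⟨ cong (_% d) ([m+n]∸[m+o]≡n∸o (m % d) (m / d * d) (n / d * d)) ⟩
  (m / d * d ∸ n / d * d) % d                    ≡⟨ cong (_% d) (*-distribʳ-∸ d (m / d) (n / d)) ⟨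
  (m / d ∸ n / d) * d % d                        ≡⟨ m*n%n≡0 (m / d ∸ n / d) d ⟩
  0                                              ∎
  where open ≡-Reasoning

[1+m∸n]%2≡1 : ∀ {m n} → n ≤ m → m % 2 ≡ n % 2 → (suc m ∸ n) % 2 ≡ 1
[1+m∸n]%2≡1 {m} {n} n≤m m%2≡n%2 = begin
  (suc m ∸ n) % 2        ≡⟨ cong (_% 2) (+-∸-assoc 1 n≤m) ⟩
  (1 + (m ∸ n)) % 2      ≡⟨ %-distribˡ-+ 1 (m ∸ n) 2 ⟩
  (1 + (m ∸ n) % 2) % 2  ≡⟨ cong (λ r → (1 + r) % 2) (m%d≡n%d⇒[m∸n]%d≡0 m n 2 m%2≡n%2) ⟩
  1                      ∎
  where open ≡-Reasoning

⌊n/2⌋≡n/2 : ∀ n → ⌊ n /2⌋ ≡ n / 2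
⌊n/2⌋≡n/2 zero          = refl
⌊n/2⌋≡n/2 (suc zero)    = refl
⌊n/2⌋≡n/2 (suc (suc n)) = trans (cong suc (⌊n/2⌋≡n/2 n)) (sym (m/n≡1+[m∸n]/n {suc (suc n)} {2} (s≤s (s≤s z≤n))))

even⇒⌊n/2⌋≡⌈n/2⌉ : ∀ n → n % 2 ≡ 0 → ⌊ n /2⌋ ≡ ⌈ n /2⌉
even⇒⌊n/2⌋≡⌈n/2⌉ zero          _       = refl
even⇒⌊n/2⌋≡⌈n/2⌉ (suc (suc n)) n%2≡0 = cong suc (even⇒⌊n/2⌋≡⌈n/2⌉ n (trans (sym ([2+n]%2≡n%2 n)) n%2≡0))

*-/2 : ∀ m n → n % 2 ≡ 0 → m * n / 2 ≡ m * ⌊ n /2⌋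
*-/2 m n n%2≡0 = trans (*-/-assoc m (m%n≡0⇒n∣m n 2 n%2≡0)) (cong (m *_) (sym (⌊n/2⌋≡n/2 n)))

even⇒*n/2≡*⌈n/2⌉ : ∀ m n → n % 2 ≡ 0 → m * n / 2 ≡ m * ⌈ n /2⌉
even⇒*n/2≡*⌈n/2⌉ m n n%2≡0 = trans (*-/2 m n n%2≡0) (cong (m *_) (even⇒⌊n/2⌋≡⌈n/2⌉ n n%2≡0))

odd⇒*[n+1]/2≡*⌈n/2⌉ : ∀ m n → n % 2 ≡ 1 → m * (n + 1) / 2 ≡ m * ⌈ n /2⌉
odd⇒*[n+1]/2≡*⌈n/2⌉ m n n%2≡1 = trans (*-/2 m (n + 1) n+1%2≡0) (cong (λ k → m * ⌊ k /2⌋) (+-comm n 1))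
  where
  n+1%2≡0 : (n + 1) % 2 ≡ 0
  n+1%2≡0 = trans (%-distribˡ-+ n 1 2) (cong (λ r → (r + 1) % 2) n%2≡1)

n≤m+m⇒⌈n/2⌉≤m : ∀ {n m} → n ≤ m + m → ⌈ n /2⌉ ≤ m
n≤m+m⇒⌈n/2⌉≤m {n} {m} n≤2m = subst (⌈ n /2⌉ ≤_) (sym (n≡⌈n+n/2⌉ m)) (⌈n/2⌉-mono n≤2m)

prev : ∀ {k} → Fin (suc k) → Fin (suc k)
prev {k} zero = fromℕ k
prev (suc i) = inject₁ i

module _ {k : ℕ} where
  open import Function.Endo.Propositional (Fin (suc k)) public using (_^_)

toℕ%≡toℕ : ∀ {k} (j : Fin (suc k)) → toℕ j % suc k ≡ toℕ j
toℕ%≡toℕ j = m≤n⇒m%n≡m (toℕ≤pred[n] j)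

toℕ-prev : ∀ {k} (j : Fin (suc k)) → toℕ (prev j) ≡ (toℕ j + k) % suc k
toℕ-prev {k} zero    = trans (toℕ-fromℕ k) (sym (m≤n⇒m%n≡m ≤-refl))
toℕ-prev {k} (suc i) = begin
  toℕ (inject₁ i)           ≡⟨ toℕ-inject₁ i ⟩
  toℕ i                     ≡⟨ m≤n⇒m%n≡m (<⇒≤ (toℕ<n i)) ⟨
  toℕ i % suc k             ≡⟨ [m+n]%n≡m%n (toℕ i) (suc k) ⟨
  (toℕ i + suc k) % suc k   ≡⟨ cong (_% suc k) (+-suc (toℕ i) k) ⟩
  (suc (toℕ i) + k) % suc k ∎
  where open ≡-Reasoning

toℕ-prev^ : ∀ {k} a (j : Fin (suc k)) → toℕ ((prev ^ a) j) ≡ (toℕ j + a * k) % suc k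
toℕ-prev^ {k} zero    j = sym (trans (cong (_% suc k) (+-identityʳ (toℕ j))) (toℕ%≡toℕ j))
toℕ-prev^ {k} (suc a) j = begin
  toℕ (prev ((prev ^ a) j))               ≡⟨ toℕ-prev ((prev ^ a) j) ⟩
  (toℕ ((prev ^ a) j) + k) % suc k        ≡⟨ cong (λ x → (x + k) % suc k) (toℕ-prev^ a j) ⟩
  ((toℕ j + a * k) % suc k + k) % suc k   ≡⟨ [m%d+n]%d≡[m+n]%d (toℕ j + a * k) k (suc k) ⟩
  (toℕ j + a * k + k) % suc k             ≡⟨ cong (_% suc k) (+-assoc (toℕ j) (a * k) k) ⟩
  (toℕ j + (a * k + k)) % suc k           ≡⟨ cong (λ x → (toℕ j + x) % suc k) (+-comm (a * k) k) ⟩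
  (toℕ j + suc a * k) % suc k             ∎
  where open ≡-Reasoning

prev^[1+k]≗id : ∀ {k} (j : Fin (suc k)) → (prev ^ suc k) j ≡ j
prev^[1+k]≗id {k} j = toℕ-injective (begin
  toℕ ((prev ^ suc k) j)       ≡⟨ toℕ-prev^ (suc k) j ⟩
  (toℕ j + suc k * k) % suc k  ≡⟨ cong (λ x → (toℕ j + x) % suc k) (*-comm (suc k) k) ⟩
  (toℕ j + k * suc k) % suc k  ≡⟨ [m+kn]%n≡m%n (toℕ j) k (suc k) ⟩
  toℕ j % suc k                ≡⟨ toℕ%≡toℕ j ⟩
  toℕ j                        ∎)
  where open ≡-Reasoning

succMod-prev : ∀ {k} (b : Fin (suc k)) → succMod (prev b) b
succMod-prev {k} b = begin
  (toℕ (prev b) + 1) % suc k           ≡⟨ cong (λ x → (x + 1) % suc k) (toℕ-prev b) ⟩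
  ((toℕ b + k) % suc k + 1) % suc k    ≡⟨ [m%d+n]%d≡[m+n]%d (toℕ b + k) 1 (suc k) ⟩
  (toℕ b + k + 1) % suc k              ≡⟨ cong (_% suc k) (+-assoc (toℕ b) k 1) ⟩
  (toℕ b + (k + 1)) % suc k            ≡⟨ cong (λ x → (toℕ b + x) % suc k) (+-comm k 1) ⟩
  (toℕ b + suc k) % suc k              ≡⟨ [m+n]%n≡m%n (toℕ b) (suc k) ⟩
  toℕ b % suc k                        ≡⟨ toℕ%≡toℕ b ⟩
  toℕ b                                ∎
  where open ≡-Reasoning

succMod⇒≡prev : ∀ {k} {a b : Fin (suc k)} → succMod a b → a ≡ prev b
succMod⇒≡prev {k} {a} {b} a+1≡b = toℕ-injective (begin
  toℕ a                                ≡⟨ toℕ%≡toℕ a ⟨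
  toℕ a % suc k                        ≡⟨ [m+n]%n≡m%n (toℕ a) (suc k) ⟨
  (toℕ a + suc k) % suc k              ≡⟨ cong (_% suc k) (+-assoc (toℕ a) 1 k) ⟨
  (toℕ a + 1 + k) % suc k              ≡⟨ [m%d+n]%d≡[m+n]%d (toℕ a + 1) k (suc k) ⟨
  ((toℕ a + 1) % suc k + k) % suc k    ≡⟨ cong (λ x → (x + k) % suc k) a+1≡b ⟩
  (toℕ b + k) % suc k                  ≡⟨ toℕ-prev b ⟨
  toℕ (prev b)                         ∎)
  where open ≡-Reasoning

prev≢id : ∀ {k} .{{_ : NonZero k}} (i : Fin (suc k)) → prev i ≢ i
prev≢id {suc k} zero    ()
prev≢id {suc k} (suc i) prev≡i = 1+n≢n (sym (trans (sym (toℕ-inject₁ i)) (cong toℕ prev≡i)))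

prev^-prev : ∀ {k} a (j : Fin (suc k)) → (prev ^ a) (prev j) ≡ prev ((prev ^ a) j)
prev^-prev zero    j = refl
prev^-prev (suc a) j = cong prev (prev^-prev a j)

sum-∘prev : ∀ {k} (f : Fin (suc k) → ℕ) → sum (f ∘ prev) ≡ sum f
sum-∘prev {k} f = trans (+-comm (f (fromℕ k)) _) (sym (sum-init-last f))

sum-∘prev^ : ∀ {k} a (f : Fin (suc k) → ℕ) → sum (f ∘ (prev ^ a)) ≡ sum f
sum-∘prev^ zero    f = refl
sum-∘prev^ (suc a) f = trans (sum-∘prev^ a (f ∘ prev)) (sum-∘prev f)

even : ℕ → Bool
even zero    = true
even (suc n) = not (even n)

alternating : ∀ {k} → Fin k → Bool
alternating j = even (toℕ j)

Covers : ∀ {k} → (Fin k → Bool) → (Fin k → Bool) → Set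
Covers r s = ∀ j → s j ≡ false → r j ≡ true

alternating-covers-right : ∀ {k} → Covers (alternating ∘ prev {k}) alternating
alternating-covers-right (suc i) 1+i-odd rewrite toℕ-inject₁ i with even (toℕ i)
... | true = refl

alternating-covers-left : ∀ {k} → Covers (alternating {suc k}) (alternating ∘ prev)
alternating-covers-left zero    _ = refl
alternating-covers-left (suc i) i-odd rewrite toℕ-inject₁ i | i-odd = refl

cell : Bool → Fin 3
cell true  = suc zero
cell false = zero

sum-alternating : ∀ k → ∑[ j < k ] toℕ (cell (alternating j)) ≡ ⌈ k /2⌉
sum-alternating zero          = refl
sum-alternating (suc zero)    = refl
sum-alternating (suc (suc k)) = cong suc (trans
  (sum-cong-≗ {k} (λ j → cong (toℕ ∘ cell) (not-involutive (even (toℕ j)))))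
  (sum-alternating k))

shifted : ∀ {k} → ℕ → Fin (suc k) → Bool
shifted a = alternating ∘ (prev ^ a)

sum-shifted : ∀ {k} a → ∑[ j < suc k ] toℕ (cell (shifted a j)) ≡ ⌈ suc k /2⌉
sum-shifted {k} a = trans (sum-∘prev^ a (toℕ ∘ cell ∘ alternating)) (sum-alternating (suc k))

shifted-covers-right : ∀ {k} a → Covers (shifted {k} a ∘ prev) (shifted a)
shifted-covers-right a j j-odd
  rewrite prev^-prev a j = alternating-covers-right ((prev ^ a) j) j-odd

-- Neighbours on the cycle of length k + 1, written as shift amounts; a shift by k + 1 is the identity.
data Adjacent (k : ℕ) : ℕ → ℕ → Set where
  forward  : ∀ {a} → Adjacent k a (suc a)
  backward : ∀ {a} → Adjacent k (suc a) a
  wrap     : Adjacent k k zero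

Adjacent⇒Covers : ∀ {k a b} → Adjacent k a b → Covers (shifted {k} a) (shifted b)
Adjacent⇒Covers {a = a} forward  j = alternating-covers-left ((prev ^ a) j)
Adjacent⇒Covers {b = b} backward j = alternating-covers-right ((prev ^ b) j)
Adjacent⇒Covers {k}     wrap     j j-odd =
  alternating-covers-left ((prev ^ k) j) (subst (λ x → alternating x ≡ false) (sym (prev^[1+k]≗id j)) j-odd)

Adjacent-of-≡suc : ∀ {k a b} → b ≡ suc a ⊎ a ≡ suc b → Adjacent k a b
Adjacent-of-≡suc (inj₁ refl) = forward
Adjacent-of-≡suc (inj₂ refl) = backward

climbThenAlternate : ℕ → ℕ → ℕ
climbThenAlternate zero    t       = t % 2
climbThenAlternate (suc p) zero    = zero
climbThenAlternate (suc p) (suc t) = suc (climbThenAlternate p t)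

climbThenAlternate-0 : ∀ p → climbThenAlternate p 0 ≡ 0
climbThenAlternate-0 zero    = refl
climbThenAlternate-0 (suc p) = refl

climbThenAlternate-+ : ∀ p t → climbThenAlternate p (p + t) ≡ p + t % 2
climbThenAlternate-+ zero    t = refl
climbThenAlternate-+ (suc p) t = cong suc (climbThenAlternate-+ p t)

climbThenAlternate-step : ∀ p t → climbThenAlternate p (suc t) ≡ suc (climbThenAlternate p t)
                                  ⊎ climbThenAlternate p t ≡ suc (climbThenAlternate p (suc t))
climbThenAlternate-step zero t with %2-alternates t
... | inj₁ (t%2≡0 , [1+t]%2≡1) = inj₁ (trans [1+t]%2≡1 (cong suc (sym t%2≡0)))
... | inj₂ (t%2≡1 , [1+t]%2≡0) = inj₂ (trans t%2≡1 (cong suc (sym [1+t]%2≡0)))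
climbThenAlternate-step (suc p) zero    = inj₁ (cong suc (climbThenAlternate-0 p))
climbThenAlternate-step (suc p) (suc t) = Sum.map (cong suc) (cong suc) (climbThenAlternate-step p t)

climbThenAlternate-end : ∀ {p t} → p ≤ t → (t ∸ p) % 2 ≡ 1 → climbThenAlternate p t ≡ suc p
climbThenAlternate-end {p} {t} p≤t [t∸p]%2≡1 = begin
  climbThenAlternate p t             ≡⟨ cong (climbThenAlternate p) (m+[n∸m]≡n p≤t) ⟨
  climbThenAlternate p (p + (t ∸ p)) ≡⟨ climbThenAlternate-+ p (t ∸ p) ⟩
  p + (t ∸ p) % 2                    ≡⟨ cong (p +_) [t∸p]%2≡1 ⟩
  p + 1                              ≡⟨ +-comm p 1 ⟩
  suc p                              ∎
  where open ≡-Reasoning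

Adjacent-around : ∀ {k m′} {c : ℕ → ℕ} → (∀ t → Adjacent k (c t) (c (suc t))) → Adjacent k (c m′) (c 0) →
                  ∀ (i : Fin (suc m′)) → Adjacent k (c (toℕ (prev i))) (c (toℕ i))
Adjacent-around {m′ = m′} steps closes zero    rewrite toℕ-fromℕ m′ = closes
Adjacent-around           steps closes (suc i) rewrite toℕ-inject₁ i = steps (toℕ i)

[≥1] : Fin 3 → ℕ
[≥1] zero    = 0
[≥1] (suc _) = 1

[=2] : Fin 3 → ℕ
[=2] (suc (suc zero)) = 1
[=2] _                = 0

toℕ≡[≥1]+[=2] : ∀ x → toℕ x ≡ [≥1] x + [=2] x
toℕ≡[≥1]+[=2] zero             = refl
toℕ≡[≥1]+[=2] (suc zero)       = refl
toℕ≡[≥1]+[=2] (suc (suc zero)) = refl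

[≥1]≡1 : ∀ {x k} → toℕ x ≡ suc k → [≥1] x ≡ 1
[≥1]≡1 {suc _} _ = refl

[=2]≡1 : ∀ {x} → toℕ x ≡ 2 → [=2] x ≡ 1
[=2]≡1 {suc (suc zero)} _ = refl

1≤+ˡ : ∀ {m n} → m ≡ 1 → 1 ≤ m + n
1≤+ˡ refl = s≤s z≤n

1≤+ʳ : ∀ {m n} → n ≡ 1 → 1 ≤ m + n
1≤+ʳ {m} refl = m≤n+m 1 m

module Torus (m′ n′ : ℕ) where

  private
    m n : ℕ
    m = suc m′
    n = suc n′

  Position : Set
  Position = Fin m × Fin n

  position : Fin (m * n) → Position
  position = remQuot n

  data OneStep : Position → Position → Set where
    down  : ∀ {i i′ j} → succMod i i′ → OneStep (i , j) (i′ , j)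
    right : ∀ {i j j′} → succMod j j′ → OneStep (i , j) (i , j′)

  arc⇒OneStep : ∀ u v → TorusArc m n u v → OneStep (position u) (position v)
  arc⇒OneStep u v = fromSum
    where
    fromSum : ∀ {i j i′ j′} → (succMod i i′ × j ≡ j′) ⊎ (i ≡ i′ × succMod j j′) → OneStep (i , j) (i′ , j′)
    fromSum (inj₁ (i+1≡i′ , refl)) = down i+1≡i′
    fromSum (inj₂ (refl , j+1≡j′)) = right j+1≡j′

  OneStep⇒arc : ∀ u v → OneStep (position u) (position v) → TorusArc m n u v
  OneStep⇒arc u v = toSum
    where
    toSum : ∀ {p q} → OneStep p q → (succMod (proj₁ p) (proj₁ q) × proj₂ p ≡ proj₂ q)
                                    ⊎ (proj₁ p ≡ proj₁ q × succMod (proj₂ p) (proj₂ q))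
    toSum (down i+1≡i′)  = inj₁ (i+1≡i′ , refl)
    toSum (right j+1≡j′) = inj₂ (refl , j+1≡j′)

  OneStep-into : ∀ {p} i j → OneStep p (i , j) → p ≡ (prev i , j) ⊎ p ≡ (i , prev j)
  OneStep-into i j (down i′+1≡i)  = inj₁ (cong (_, j) (succMod⇒≡prev i′+1≡i))
  OneStep-into i j (right j′+1≡j) = inj₂ (cong (i ,_) (succMod⇒≡prev j′+1≡j))

  in-neighbour : ∀ {w} i j → TorusArc m n w (combine i j) →
                 w ≡ combine (prev i) j ⊎ w ≡ combine i (prev j)
  in-neighbour {w} i j wv =
    Sum.map at at (OneStep-into i j
      (subst (OneStep (position w)) (remQuot-combine i j) (arc⇒OneStep w (combine i j) wv)))
    where
    at : ∀ {p} → position w ≡ p → w ≡ uncurry combine p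
    at refl = sym (combine-remQuot {m} n w)

  OneStep⇒combine-arc : ∀ i′ j′ i j → OneStep (i′ , j′) (i , j) → TorusArc m n (combine i′ j′) (combine i j)
  OneStep⇒combine-arc i′ j′ i j step = OneStep⇒arc (combine i′ j′) (combine i j)
    (subst₂ OneStep (sym (remQuot-combine i′ j′)) (sym (remQuot-combine i j)) step)

  arc-from-above : ∀ i j → TorusArc m n (combine (prev i) j) (combine i j)
  arc-from-above i j = OneStep⇒combine-arc (prev i) j i j (down (succMod-prev i))

  arc-from-left : ∀ i j → TorusArc m n (combine i (prev j)) (combine i j)
  arc-from-left i j = OneStep⇒combine-arc i (prev j) i j (right (succMod-prev j))

  ∀-combine : ∀ {ℓ} {P : Fin (m * n) → Set ℓ} → (∀ i j → P (combine i j)) → ∀ v → P v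
  ∀-combine {P = P} p v = subst P (combine-remQuot {m} n v) (uncurry p (position v))

  fromRows : (Fin m → Fin n → Bool) → Fin (m * n) → Fin 3
  fromRows R v = cell (uncurry R (position v))

  fromRows-combine : ∀ R i j → fromRows R (combine i j) ≡ cell (R i j)
  fromRows-combine R i j = cong (cell ∘ uncurry R) (remQuot-combine i j)

  weight-fromRows : ∀ R → weight (CycleProduct m n) (fromRows R) ≡ ∑[ i < m ] ∑[ j < n ] toℕ (cell (R i j))
  weight-fromRows R = trans (weight≡∑∑ m n (fromRows R))
                            (sum-cong-≗ (λ i → sum-cong-≗ (λ j → cong toℕ (fromRows-combine R i j))))

  fromRows-italian : .{{_ : NonZero m′}} (R : Fin m → Fin n → Bool) →
                     (∀ i → Covers (R i ∘ prev) (R i)) → (∀ i → Covers (R (prev i)) (R i)) →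
                     IsItalianDF (CycleProduct m n) (fromRows R)
  fromRows-italian R left above = ∀-combine λ i j fij≡0 →
    let Rij≡false = cell≡zero (trans (sym (fromRows-combine R i j)) (toℕ-injective fij≡0)) in
    inj₂ (combine (prev i) j , combine i (prev j) , distinct i j , arc-from-above i j , arc-from-left i j ,
          value-1 (prev i) j (above i j Rij≡false) , value-1 i (prev j) (left i j Rij≡false))
    where
    cell≡zero : ∀ {b} → cell b ≡ zero → b ≡ false
    cell≡zero {false} _ = refl
    value-1 : ∀ i j → R i j ≡ true → toℕ (fromRows R (combine i j)) ≡ 1
    value-1 i j Rij≡true = cong toℕ (trans (fromRows-combine R i j) (cong cell Rij≡true))
    distinct : ∀ i j → combine (prev i) j ≢ combine i (prev j)
    distinct i j = prev≢id i ∘ combine-injectiveˡ (prev i) j i (prev j)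

  walk⇒italian : .{{_ : NonZero m′}} (c : ℕ → ℕ) →
                 (∀ t → Adjacent n′ (c t) (c (suc t))) → Adjacent n′ (c m′) (c 0) →
                 ∃[ f ] (IsItalianDF (CycleProduct m n) f × weight (CycleProduct m n) f ≡ m * ⌈ n /2⌉)
  walk⇒italian c steps closes =
    fromRows R , fromRows-italian R (shifted-covers-right ∘ c ∘ toℕ) (Adjacent⇒Covers ∘ Adjacent-around steps closes) ,
    (begin
      weight (CycleProduct m n) (fromRows R)    ≡⟨ weight-fromRows R ⟩
      ∑[ i < m ] ∑[ j < n ] toℕ (cell (R i j))  ≡⟨ sum-cong-≗ {m} (sum-shifted {n′} ∘ c ∘ toℕ) ⟩
      ∑[ i < m ] ⌈ n /2⌉                        ≡⟨ sum-const m ⌈ n /2⌉ ⟩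
      m * ⌈ n /2⌉                               ∎)
    where
    open ≡-Reasoning
    R : Fin m → Fin n → Bool
    R i = shifted (c (toℕ i))

  module _ {f : Fin (m * n) → Fin 3} (italian : IsItalianDF (CycleProduct m n) f) where

    private
      g : Fin m → Fin n → Fin 3
      g i j = f (combine i j)

    italian-local : ∀ i j → 1 ≤ [≥1] (g i j) + ([=2] (g (prev i) j) + [≥1] (g i (prev j)))
    italian-local i j with g i j in gij≡x
    ... | suc _ = s≤s z≤n
    ... | zero with italian (combine i j) (cong toℕ gij≡x)
    ... | inj₁ (w , wv , fw≡2) with in-neighbour {w} i j wv
    ...   | inj₁ refl = 1≤+ˡ ([=2]≡1 fw≡2)
    ...   | inj₂ refl = 1≤+ʳ ([≥1]≡1 fw≡2)
    italian-local i j | zero | inj₂ (x₁ , x₂ , x₁≢x₂ , x₁v , x₂v , fx₁≡1 , fx₂≡1)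
      with in-neighbour {x₁} i j x₁v | in-neighbour {x₂} i j x₂v
    ... | inj₂ refl | _         = 1≤+ʳ ([≥1]≡1 fx₁≡1)
    ... | _         | inj₂ refl = 1≤+ʳ ([≥1]≡1 fx₂≡1)
    ... | inj₁ refl | inj₁ refl = ⊥-elim (x₁≢x₂ refl)

    private
      A T : Fin m → ℕ
      A i = ∑[ j < n ] [≥1] (g i j)
      T i = ∑[ j < n ] [=2] (g i j)

    row-bound : ∀ i → ⌈ n /2⌉ ≤ A i + T (prev i)
    row-bound i = n≤m+m⇒⌈n/2⌉≤m (begin
      n                                   ≡⟨ *-identityʳ n ⟨
      n * 1                               ≤⟨ *≤sum _ (italian-local i) ⟩
      ∑[ j < n ] ([≥1] (g i j) + ([=2] (g (prev i) j) + [≥1] (g i (prev j))))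
        ≡⟨ ∑-distrib-+ (λ j → [≥1] (g i j)) (λ j → [=2] (g (prev i) j) + [≥1] (g i (prev j))) ⟩
      A i + ∑[ j < n ] ([=2] (g (prev i) j) + [≥1] (g i (prev j)))
        ≡⟨ cong (A i +_) (∑-distrib-+ (λ j → [=2] (g (prev i) j)) (λ j → [≥1] (g i (prev j)))) ⟩
      A i + (T (prev i) + ∑[ j < n ] [≥1] (g i (prev j)))
        ≡⟨ cong (λ x → A i + (T (prev i) + x)) (sum-∘prev (λ j → [≥1] (g i j))) ⟩
      A i + (T (prev i) + A i)            ≡⟨ +-assoc (A i) (T (prev i)) (A i) ⟨
      A i + T (prev i) + A i              ≤⟨ +-monoʳ-≤ (A i + T (prev i)) (m≤m+n (A i) (T (prev i))) ⟩
      A i + T (prev i) + (A i + T (prev i)) ∎)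
      where open ≤-Reasoning

    weight≡∑rows : weight (CycleProduct m n) f ≡ ∑[ i < m ] (A i + T (prev i))
    weight≡∑rows = begin
      weight (CycleProduct m n) f               ≡⟨ weight≡∑∑ m n f ⟩
      ∑[ i < m ] ∑[ j < n ] toℕ (g i j)         ≡⟨ sum-cong-≗ (λ i → sum-cong-≗ (toℕ≡[≥1]+[=2] ∘ g i)) ⟩
      ∑[ i < m ] ∑[ j < n ] ([≥1] (g i j) + [=2] (g i j))
        ≡⟨ sum-cong-≗ (λ i → ∑-distrib-+ (λ j → [≥1] (g i j)) (λ j → [=2] (g i j))) ⟩
      ∑[ i < m ] (A i + T i)                    ≡⟨ ∑-distrib-+ A T ⟩
      sum A + sum T                             ≡⟨ cong (sum A +_) (sum-∘prev T) ⟨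
      sum A + ∑[ i < m ] T (prev i)             ≡⟨ ∑-distrib-+ A (T ∘ prev) ⟨
      ∑[ i < m ] (A i + T (prev i))             ∎
      where open ≡-Reasoning

    italian⇒weight≥ : m * ⌈ n /2⌉ ≤ weight (CycleProduct m n) f
    italian⇒weight≥ = subst (m * ⌈ n /2⌉ ≤_) (sym weight≡∑rows) (*≤sum _ row-bound)

  γI-of-walk : .{{_ : NonZero m′}} (c : ℕ → ℕ) →
               (∀ t → Adjacent n′ (c t) (c (suc t))) → Adjacent n′ (c m′) (c 0) →
               ItalianDominationNumber (CycleProduct m n) (m * ⌈ n /2⌉)
  γI-of-walk c steps closes = walk⇒italian c steps closes , λ _ → italian⇒weight≥

  γI-of-climb : .{{_ : NonZero m′}} → ∀ p → p ≤ m′ → (m′ ∸ p) % 2 ≡ 1 → Adjacent n′ (suc p) 0 →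
                ItalianDominationNumber (CycleProduct m n) (m * ⌈ n /2⌉)
  γI-of-climb p p≤m′ [m′∸p]%2≡1 closes =
    γI-of-walk (climbThenAlternate p) (Adjacent-of-≡suc ∘ climbThenAlternate-step p)
      (subst₂ (Adjacent n′) (sym (climbThenAlternate-end p≤m′ [m′∸p]%2≡1)) (sym (climbThenAlternate-0 p)) closes)

mainTheorem4 : (m n : ℕ) → 2 ≤ m → 2 ≤ n →
    ((m % 2 ≡ 0 × n % 2 ≡ 0) → ItalianDominationNumber (CycleProduct m n) ((m * n) / 2))
    × ((m % 2 ≡ 0 × n % 2 ≡ 1) → ItalianDominationNumber (CycleProduct m n) ((m * (n + 1)) / 2))
    × ((m % 2 ≡ 1 × n % 2 ≡ 1 × n ≤ m) → ItalianDominationNumber (CycleProduct m n) ((m * (n + 1)) / 2))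
mainTheorem4 m@(suc m′@(suc a)) n@(suc n′@(suc b)) (s≤s (s≤s _)) (s≤s (s≤s _)) =
    (λ (m-even , n-even) → rewrite-weight (even⇒*n/2≡*⌈n/2⌉ m n n-even) (γI-even m-even))
  , (λ (m-even , n-odd) → rewrite-weight (odd⇒*[n+1]/2≡*⌈n/2⌉ m n n-odd) (γI-even m-even))
  , (λ (m-odd , n-odd , n≤m) → rewrite-weight (odd⇒*[n+1]/2≡*⌈n/2⌉ m n n-odd) (γI-odd m-odd n-odd n≤m))
  where
  open Torus m′ n′

  rewrite-weight : ∀ {k} → k ≡ m * ⌈ n /2⌉ → ItalianDominationNumber (CycleProduct m n) (m * ⌈ n /2⌉) →
                   ItalianDominationNumber (CycleProduct m n) k
  rewrite-weight k≡ = subst (ItalianDominationNumber (CycleProduct m n)) (sym k≡)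

  γI-even : m % 2 ≡ 0 → ItalianDominationNumber (CycleProduct m n) (m * ⌈ n /2⌉)
  γI-even m-even = γI-of-climb 0 z≤n (%-pred-≡0 {m′} {2} m-even) backward

  γI-odd : m % 2 ≡ 1 → n % 2 ≡ 1 → n ≤ m → ItalianDominationNumber (CycleProduct m n) (m * ⌈ n /2⌉)
  γI-odd m-odd n-odd n≤m =
    γI-of-climb b (<⇒≤ (≤-pred n≤m)) ([1+m∸n]%2≡1 n≤m (trans m-odd (sym n-odd))) wrap
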